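{- Let $P$ be a functional Pure Type System containing at least one sort $s_0$. For every term $t$ of $P$ such that $|t|$ (resp. $\|t\|$) is defined, $|t|^*=t$ (resp. $\|t\|^*=t$).
   Context: A Pure Type System $P=\langle S,A,R\rangle$ has sorts $S$, axioms $A\subseteq S\times S$, rules $R\subseteq S\times S\times S$, usual PTS typing; functional means axioms and rules are functional relations in their first one, resp. two, components. $\lambda\Pi_P$-terms: $t::=x\mid Type\mid Kind\mid \Pi x:t~t\mid\lambda x:t~t\mid t~t$, with constants $U_s,\varepsilon_s$ ($s\in S$), $\dot{s_1}$ ($\langle s_1,s_2\rangle\in A$), $\dot\Pi_{\langle s_1,s_2,s_3\rangle}$ ($\langle s_1,s_2,s_3\rangle\in R$). Translation of $t$ well-typed in $P$: $|x|=x$; $|s|=\dot s$; $|\Pi x:A~B|=\dot\Pi_{\langle s_1,s_2,s_3\rangle}~|A|~(\lambda x:(\varepsilon_{s_1}~|A|)~|B|)$ with $s_1,s_2,s_3$ the types of $A$, $B$, $\Pi x:A~B$; $|\lambda x:A~t|=\lambda x:(\varepsilon_s~|A|)~|t|$ with $s$ the type of $A$; $|t~u|=|t|~|u|$. For $A$ of type a sort $s$, $\|A\|=\varepsilon_s~|A|$; for a non-typable sort $s'$, $\|s'\|=U_{s'}$. Back translation from $\lambda\Pi_P$-terms to $P$-terms: $x^*=x$; $Type^*=Kind^*=s_0$; $\dot s^*=s$; $U_s^*=s$; $(\Pi x:A~B)^*=\Pi x:A^*~B^*$; $(\lambda x:A~t)^*=\lambda x:A^*~t^*$; $(\dot\Pi_{\langle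 s_1,s_2,s_3\rangle}~A~B)^*=\Pi x:A^*~(B^*~x)$; $(\varepsilon_s~u)^*=u^*$; $(t~u)^*=t^*~u^*$ otherwise. -}

module Defs where

open import Data.Nat using (ℕ; zero; suc)
open import Data.List using (List; []; _∷_)
open import Data.Product using (Σ; _×_; _,_; ∃)
open import Relation.Nullary using (¬_)
open import Relation.Binary.PropositionalEquality using (_≡_)
open import Relation.Binary.Construct.Closure.Equivalence using (EqClosure)

record PTS : Set₁ where
  field
    Sort  : Set
    Axiom : Sort → Sort → Set
    Rule  : Sort → Sort → Sort → Set

record Functional (P : PTS) : Set where
  open PTS P
  field
    axiom-fun : ∀ {s s′ s″} → Axiom s s′ → Axiom s s″ → s′ ≡ s″
    rule-fun  : ∀ {s₁ s₂ s₃ s₃′} → Rule s₁ s₂ s₃ → Rule s₁ s₂ s₃′ → s₃ ≡ s₃′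

module PTSDefs (P : PTS) where
  open PTS P

  -- Terms of P (de Bruijn indices; binders Π and λ bind index 0 in
  -- their second argument).
  data Term : Set where
    var  : ℕ → Term
    sort : Sort → Term
    Π    : Term → Term → Term
    lam  : Term → Term → Term
    app  : Term → Term → Term

  ext : (ℕ → ℕ) → ℕ → ℕ
  ext ρ zero    = zero
  ext ρ (suc n) = suc (ρ n)

  rename : (ℕ → ℕ) → Term → Term
  rename ρ (var x)   = var (ρ x)
  rename ρ (sort s)  = sort s
  rename ρ (Π A B)   = Π (rename ρ A) (rename (ext ρ) B)
  rename ρ (lam A t) = lam (rename ρ A) (rename (ext ρ) t)
  rename ρ (app t u) = app (rename ρ t) (rename ρ u)

  weaken : Term → Term
  weaken = rename suc

  exts : (ℕ → Term) → ℕ → Term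
  exts σ zero    = var zero
  exts σ (suc n) = weaken (σ n)

  subst : (ℕ → Term) → Term → Term
  subst σ (var x)   = σ x
  subst σ (sort s)  = sort s
  subst σ (Π A B)   = Π (subst σ A) (subst (exts σ) B)
  subst σ (lam A t) = lam (subst σ A) (subst (exts σ) t)
  subst σ (app t u) = app (subst σ t) (subst σ u)

  _[_] : Term → Term → Term
  t [ u ] = subst σ t
    where
    σ : ℕ → Term
    σ zero    = u
    σ (suc n) = var n

  data _⟶β_ : Term → Term → Set where
    β     : ∀ {A t u} → app (lam A t) u ⟶β (t [ u ])
    Πˡ    : ∀ {A A′ B} → A ⟶β A′ → Π A B ⟶β Π A′ B
    Πʳ    : ∀ {A B B′} → B ⟶β B′ → Π A B ⟶β Π A B′
    lamˡ  : ∀ {A A′ t} → A ⟶β A′ → lam A t ⟶β lam A′ t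
    lamʳ  : ∀ {A t t′} → t ⟶β t′ → lam A t ⟶β lam A t′
    appˡ  : ∀ {t t′ u} → t ⟶β t′ → app t u ⟶β app t′ u
    appʳ  : ∀ {t u u′} → u ⟶β u′ → app t u ⟶β app t u′

  _≡β_ : Term → Term → Set
  _≡β_ = EqClosure _⟶β_

  Context : Set
  Context = List Term   -- head is the type of index 0

  data _⊢_∶_ : Context → Term → Term → Set where
    axiom : ∀ {s s′} → Axiom s s′ → [] ⊢ sort s ∶ sort s′
    start : ∀ {Γ A s} → Γ ⊢ A ∶ sort s → (A ∷ Γ) ⊢ var zero ∶ weaken A
    weak  : ∀ {Γ t T A s} → Γ ⊢ t ∶ T → Γ ⊢ A ∶ sort s →
            (A ∷ Γ) ⊢ weaken t ∶ weaken T
    prod  : ∀ {Γ A B s₁ s₂ s₃} → Rule s₁ s₂ s₃ →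
            Γ ⊢ A ∶ sort s₁ → (A ∷ Γ) ⊢ B ∶ sort s₂ → Γ ⊢ Π A B ∶ sort s₃
    abs   : ∀ {Γ A B t s} → (A ∷ Γ) ⊢ t ∶ B → Γ ⊢ Π A B ∶ sort s →
            Γ ⊢ lam A t ∶ Π A B
    appl  : ∀ {Γ t u A B} → Γ ⊢ t ∶ Π A B → Γ ⊢ u ∶ A →
            Γ ⊢ app t u ∶ (B [ u ])
    conv  : ∀ {Γ t T T′ s} → Γ ⊢ t ∶ T → Γ ⊢ T′ ∶ sort s → T ≡β T′ →
            Γ ⊢ t ∶ T′

  data LTerm : Set where
    var   : ℕ → LTerm
    Type  : LTerm
    Kind  : LTerm
    Π     : LTerm → LTerm → LTerm
    lam   : LTerm → LTerm → LTerm
    app   : LTerm → LTerm → LTerm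
    U     : Sort → LTerm
    ε     : Sort → LTerm
    sdot  : (s₁ s₂ : Sort) → Axiom s₁ s₂ → LTerm
    Πdot  : (s₁ s₂ s₃ : Sort) → Rule s₁ s₂ s₃ → LTerm

  -- Translation |t| (relation: "|t| is defined in context Γ and equals t′").
  -- The sorts s₁,s₂,s₃ are the types of A, B, Π x:A B.
  data Trans : Context → Term → LTerm → Set where
    t-var  : ∀ {Γ x} → Trans Γ (var x) (var x)
    t-sort : ∀ {Γ s s′} (a : Axiom s s′) → Trans Γ (sort s) (sdot s s′ a)
    t-Π    : ∀ {Γ A B A′ B′ s₁ s₂ s₃} (r : Rule s₁ s₂ s₃) →
             Γ ⊢ A ∶ sort s₁ → (A ∷ Γ) ⊢ B ∶ sort s₂ → Γ ⊢ Π A B ∶ sort s₃ →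
             Trans Γ A A′ → Trans (A ∷ Γ) B B′ →
             Trans Γ (Π A B)
               (app (app (Πdot s₁ s₂ s₃ r) A′) (lam (app (ε s₁) A′) B′))
    t-lam  : ∀ {Γ A t A′ t′ s} → Γ ⊢ A ∶ sort s →
             Trans Γ A A′ → Trans (A ∷ Γ) t t′ →
             Trans Γ (lam A t) (lam (app (ε s) A′) t′)
    t-app  : ∀ {Γ t u t′ u′} → Trans Γ t t′ → Trans Γ u u′ →
             Trans Γ (app t u) (app t′ u′)

  data TransT : Context → Term → LTerm → Set where
    tt-type : ∀ {Γ A A′ s} → Γ ⊢ A ∶ sort s → Trans Γ A A′ →
              TransT Γ A (app (ε s) A′)
    tt-sort : ∀ {Γ s′} → ¬ (Σ Sort (Axiom s′)) → TransT Γ (sort s′) (U s′)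

  module Back (s₀ : Sort) where
    back : LTerm → Term
    back (var x)   = var x
    back Type      = sort s₀
    back Kind      = sort s₀
    back (Π A B)   = Π (back A) (back B)
    back (lam A t) = lam (back A) (back t)
    back (U s)     = sort s
    back (ε s)     = sort s₀   -- unapplied ε_s is not in the image; arbitrary
    back (sdot s₁ s₂ a) = sort s₁
    back (Πdot s₁ s₂ s₃ r) = sort s₀  -- unapplied Π̇ is not in the image; arbitrary
    back (app (app (Πdot s₁ s₂ s₃ r) A) B) =
      Π (back A) (app (weaken (back B)) (var zero))
    back (app (ε s) u) = back u
    back (app t u) = app (back t) (back u)

  WellTyped : Context → Term → Set
  WellTyped Γ t = ∃ λ T → Γ ⊢ t ∶ T

{-# OPTIONS --safe #-}
-- Back translation undoes the translation clause by clause.  The only clause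
-- that is not literally inverted is Π: |Π x:A B| = Π̇ |A| (λx:ε|A|. |B|) comes
-- back as Π x:A* ((λx:A*. B*) x), which is B* only after one β-step; this is
-- why the result holds up to β-conversion.
module Submission where

open import Defs
open import Data.Nat using (zero; suc)
open import Data.Product using (_×_; _,_)
open import Relation.Binary.PropositionalEquality using (_≡_; refl; cong; cong₂)
open import Relation.Binary.Construct.Closure.Equivalence using (gmap; transitive)
open import Relation.Binary.Construct.Closure.ReflexiveTransitive using (ε; _◅_)
open import Relation.Binary.Construct.Closure.Symmetric using (fwd)

module Properties (P : PTS) where
  open PTS P
  open PTSDefs P

  exts-ext-cancel : ∀ {σ ρ} → (∀ x → σ (ρ x) ≡ var x) → ∀ x → exts σ (ext ρ x) ≡ var x
  exts-ext-cancel σρ≗var zero    = refl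
  exts-ext-cancel σρ≗var (suc x) = cong weaken (σρ≗var x)

  subst-rename-cancel : ∀ {σ ρ} → (∀ x → σ (ρ x) ≡ var x) → ∀ t → subst σ (rename ρ t) ≡ t
  subst-rename-cancel σρ≗var (var x)   = σρ≗var x
  subst-rename-cancel σρ≗var (sort s)  = refl
  subst-rename-cancel σρ≗var (Π A B)   =
    cong₂ Π (subst-rename-cancel σρ≗var A) (subst-rename-cancel (exts-ext-cancel σρ≗var) B)
  subst-rename-cancel σρ≗var (lam A t) =
    cong₂ lam (subst-rename-cancel σρ≗var A) (subst-rename-cancel (exts-ext-cancel σρ≗var) t)
  subst-rename-cancel σρ≗var (app t u) =
    cong₂ app (subst-rename-cancel σρ≗var t) (subst-rename-cancel σρ≗var u)

  rename-ext-suc-[var₀] : ∀ t → (rename (ext suc) t [ var zero ]) ≡ t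
  rename-ext-suc-[var₀] t = subst-rename-cancel (λ { zero → refl ; (suc x) → refl }) t

  ≡⇒≡β : ∀ {t u} → t ≡ u → t ≡β u
  ≡⇒≡β refl = ε

  _⟨≡β⟩_ : ∀ {t u v} → t ≡β u → u ≡β v → t ≡β v
  _⟨≡β⟩_ = transitive _⟶β_

  Π-cong : ∀ {A A′ B B′} → A ≡β A′ → B ≡β B′ → Π A B ≡β Π A′ B′
  Π-cong {B = B} A≡A′ B≡B′ = gmap (λ A → Π A B) Πˡ A≡A′ ⟨≡β⟩ gmap (Π _) Πʳ B≡B′

  lam-cong : ∀ {A A′ t t′} → A ≡β A′ → t ≡β t′ → lam A t ≡β lam A′ t′
  lam-cong {t = t} A≡A′ t≡t′ = gmap (λ A → lam A t) lamˡ A≡A′ ⟨≡β⟩ gmap (lam _) lamʳ t≡t′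

  app-cong : ∀ {t t′ u u′} → t ≡β t′ → u ≡β u′ → app t u ≡β app t′ u′
  app-cong {u = u} t≡t′ u≡u′ = gmap (λ t → app t u) appˡ t≡t′ ⟨≡β⟩ gmap (app _) appʳ u≡u′

  weaken-lam-var₀-β : ∀ A t → app (weaken (lam A t)) (var zero) ≡β t
  weaken-lam-var₀-β A t = fwd β ◅ ≡⇒≡β (rename-ext-suc-[var₀] t)

  module BackTranslation (s₀ : Sort) where
    open Back s₀

    -- The image of the translation is never headed by ε or Π̇, so the
    -- catch-all clause of back applies; the nested cases expose the head.
    back-app-Trans : ∀ {Γ t t′} u′ → Trans Γ t t′ → back (app t′ u′) ≡ app (back t′) (back u′)
    back-app-Trans u′ t-var                           = refl
    back-app-Trans u′ (t-sort _)                      = refl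
    back-app-Trans u′ (t-Π _ _ _ _ _ _)               = refl
    back-app-Trans u′ (t-lam _ _ _)                   = refl
    back-app-Trans u′ (t-app t-var _)                 = refl
    back-app-Trans u′ (t-app (t-sort _) _)            = refl
    back-app-Trans u′ (t-app (t-Π _ _ _ _ _ _) _)     = refl
    back-app-Trans u′ (t-app (t-lam _ _ _) _)         = refl
    back-app-Trans u′ (t-app (t-app _ _) _)           = refl

    back-Trans : ∀ {Γ t t′} → Trans Γ t t′ → back t′ ≡β t
    back-Trans t-var                    = ε
    back-Trans (t-sort _)               = ε
    back-Trans (t-Π _ _ _ _ tA tB)      =
      Π-cong (back-Trans tA) (weaken-lam-var₀-β _ _ ⟨≡β⟩ back-Trans tB)
    back-Trans (t-lam _ tA tt)          = lam-cong (back-Trans tA) (back-Trans tt)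
    back-Trans (t-app {u′ = u′} tt tu)  =
      ≡⇒≡β (back-app-Trans u′ tt) ⟨≡β⟩ app-cong (back-Trans tt) (back-Trans tu)

    back-TransT : ∀ {Γ t t′} → TransT Γ t t′ → back t′ ≡β t
    back-TransT (tt-type _ tA) = back-Trans tA
    back-TransT (tt-sort _)    = ε

proposition11 : (P : PTS) → Functional P → (s₀ : PTS.Sort P) →
    let open PTSDefs P in
    let open Back s₀ in
    (∀ Γ t t′ → WellTyped Γ t → Trans Γ t t′ → back t′ ≡β t)
    × (∀ Γ t t′ → TransT Γ t t′ → back t′ ≡β t)
proposition11 P _ s₀ =
  (λ _ _ _ _ → back-Trans) , (λ _ _ _ → back-TransT)
  where open Properties.BackTranslation P s₀ using (back-Trans; back-TransT)
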